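{- Let $n\ge 1$ and $w\ge 1$ be integers and let $\mathcal C\subseteq\{0,1,2\}^n$ be a code all of whose codewords have $\ell_1$-weight $w$. For a codeword $\bm u$, let $K_{\bm u}$ denote the complete subgraph of $K_n$ (vertex set $[n]$) on the vertex set $supp(\bm u)$. Then $\mathcal C$ is an $(n,2w-2,w)_3$ code if and only if both of the following hold: (a') the set $\{K_{\bm u}:\bm u\in\mathcal C\}$ forms a packing of $K_n$, i.e. every edge of $K_n$ lies in at most one $K_{\bm u}$ (equivalently $|supp(\bm u)\cap supp(\bm v)|\le 1$ for distinct $\bm u,\bm v\in\mathcal C$); (b') for each $i\in[n]$ there is at most one codeword $\bm u\in\mathcal C$ with $u_i=2$.
   Context: For $\bm u,\bm v\in\{0,1,2\}^n$, the $\ell_1$-distance is $d(\bm u,\bm v)=\sum_{i=1}^n|u_i-v_i|$ (computed in $\mathbb Z$), and the $\ell_1$-weight of $\bm u$ is $d(\bm u,\bm 0)$. The support is $supp(\bm u)=\{i\in[n]:u_i\neq 0\}$. An $(n,d,w)_3$ code is a subset of $\{0,1,2\}^n$ in which every codeword has $\ell_1$-weight $w$ and any two distinct codewords have $\ell_1$-distance at least $d$. A packing of a graph $G$ is a set of subgraphs such that each edge of $G$ lies in at most one of them. -}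

module Defs where

open import Data.Nat using (ℕ; zero; suc; _+_; _≥_)
open import Data.Fin using (Fin; toℕ)
open import Data.Nat.Base using (∣_-_∣)
open import Relation.Binary.PropositionalEquality using (_≡_)
open import Relation.Nullary using (¬_)
open import Data.Product using (_×_)

Word : ℕ → Set
Word n = Fin n → Fin 3

-- equality of words (pointwise; words are functions and we avoid funext)
_≐_ : ∀ {n} → Word n → Word n → Set
u ≐ v = ∀ i → u i ≡ v i

sumFin : ∀ {n} → (Fin n → ℕ) → ℕ
sumFin {zero} f = 0
sumFin {suc n} f = f Fin.zero + sumFin {n} (λ i → f (Fin.suc i))
  where import Data.Fin as Fin

-- ℓ1-distance, computed in ℕ (= ℤ values since all terms nonnegative)
dist : ∀ {n} → Word n → Word n → ℕ
dist u v = sumFin (λ i → ∣ toℕ (u i) - toℕ (v i) ∣)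

weight : ∀ {n} → Word n → ℕ
weight {n} u = sumFin (λ i → toℕ (u i))

InSupp : ∀ {n} → Word n → Fin n → Set
InSupp u i = ¬ (toℕ (u i) ≡ 0)

Code : ℕ → Set₁
Code n = Word n → Set

ConstantWeight : ∀ {n} → Code n → ℕ → Set
ConstantWeight C w = ∀ u → C u → weight u ≡ w

IsCode : (n d w : ℕ) → Code n → Set
IsCode n d w C =
  ConstantWeight C w ×
  (∀ u v → C u → C v → ¬ (u ≐ v) → dist u v ≥ d)

-- the edge {i,j} (i ≠ j) of K_n lies in K_u, the complete graph on supp(u)
EdgeIn : ∀ {n} → Fin n → Fin n → Word n → Set
EdgeIn i j u = InSupp u i × InSupp u j

IsPacking : ∀ {n} → Code n → Set
IsPacking {n} C =
  ∀ (i j : Fin n) → ¬ (i ≡ j) →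
  ∀ u v → C u → C v → EdgeIn i j u → EdgeIn i j v → u ≐ v

AtMostOneTwo : ∀ {n} → Code n → Set
AtMostOneTwo {n} C =
  ∀ (i : Fin n) u v → C u → C v → toℕ (u i) ≡ 2 → toℕ (v i) ≡ 2 → u ≐ v

-- Since ∣a - b∣ + 2 min(a, b) = a + b, summing over coordinates gives
-- d(u, v) + 2 Σᵢ min(uᵢ, vᵢ) = wt(u) + wt(v) = 2w for codewords u, v.  So
-- d(u, v) ≥ 2w - 2 exactly when Σᵢ min(uᵢ, vᵢ) ≤ 1, and since the entries lie
-- in {0,1,2} this sum is at least 2 exactly when u and v are both 2 at some
-- coordinate or are both nonzero at two distinct coordinates.
module Submission where

open import Defs
open import Data.Nat using (ℕ; zero; suc; _+_; _*_; _∸_; _⊓_; _≤_; _≥_; z≤n; s≤s; s≤s⁻¹)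
open import Data.Nat.Base using (∣_-_∣)
open import Data.Nat.Properties
open import Data.Nat.Tactic.RingSolver using (solve-∀)
open import Algebra.Properties.Semiring.Sum +-*-semiring
  using (sum; sum-cong-≗; ∑-distrib-+; *-distribˡ-sum)
open import Data.Fin using (Fin; toℕ)
import Data.Fin as Fin
import Data.Fin.Properties as Finₚ
open import Data.Product using (Σ; ∃; _×_; _,_)
open import Data.Sum using (_⊎_; inj₁; inj₂; [_,_])
open import Function.Base using (_∘_)
open import Function.Bundles using (_⇔_; mk⇔; Equivalence)
open import Relation.Nullary using (¬_; Dec; contradiction)
open import Relation.Nullary.Decidable using (decidable-stable)
open import Relation.Binary.PropositionalEquality
  using (_≡_; _≢_; refl; sym; cong; cong₂; subst; module ≡-Reasoning)

∣m-n∣+2*[m⊓n]≡m+n : ∀ m n → ∣ m - n ∣ + 2 * (m ⊓ n) ≡ m + n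
∣m-n∣+2*[m⊓n]≡m+n zero    n       = +-identityʳ n
∣m-n∣+2*[m⊓n]≡m+n (suc m) zero    = refl
∣m-n∣+2*[m⊓n]≡m+n (suc m) (suc n) = begin
  ∣ m - n ∣ + 2 * suc (m ⊓ n)   ≡⟨ shift ∣ m - n ∣ (m ⊓ n) ⟩
  2 + (∣ m - n ∣ + 2 * (m ⊓ n)) ≡⟨ cong (2 +_) (∣m-n∣+2*[m⊓n]≡m+n m n) ⟩
  2 + (m + n)                   ≡⟨ sym (+-suc (suc m) n) ⟩
  suc m + suc n                 ∎
  where
  open ≡-Reasoning
  shift : ∀ a k → a + 2 * suc k ≡ 2 + (a + 2 * k)
  shift = solve-∀

1≤m⊓n⇔ : ∀ {m n} → 1 ≤ m ⊓ n ⇔ (m ≢ 0 × n ≢ 0)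
1≤m⊓n⇔ {m} {n} = mk⇔
  (λ 1≤m⊓n → n>0⇒n≢0 (m≤n⊓o⇒m≤n m n 1≤m⊓n) , n>0⇒n≢0 (m≤n⊓o⇒m≤o m n 1≤m⊓n))
  (λ (m≢0 , n≢0) → ⊓-glb (n≢0⇒n>0 m≢0) (n≢0⇒n>0 n≢0))

2≤toℕ⇒toℕ≡2 : (a : Fin 3) → 2 ≤ toℕ a → toℕ a ≡ 2
2≤toℕ⇒toℕ≡2 a = ≤-antisym (Finₚ.toℕ≤pred[n] a)

sumFin≡sum : ∀ {n} (f : Fin n → ℕ) → sumFin f ≡ sum f
sumFin≡sum {zero}  f = refl
sumFin≡sum {suc n} f = cong (f Fin.zero +_) (sumFin≡sum (f ∘ Fin.suc))

term≤sumFin : ∀ {n} (f : Fin n → ℕ) i → f i ≤ sumFin f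
term≤sumFin f Fin.zero    = m≤m+n _ _
term≤sumFin f (Fin.suc i) = ≤-trans (term≤sumFin (f ∘ Fin.suc) i) (m≤n+m _ _)

two-terms≤sumFin : ∀ {n} (f : Fin n → ℕ) {i j} → i ≢ j → f i + f j ≤ sumFin f
two-terms≤sumFin f {Fin.zero}  {Fin.zero}  i≢j = contradiction refl i≢j
two-terms≤sumFin f {Fin.zero}  {Fin.suc j} _   =
  +-monoʳ-≤ (f Fin.zero) (term≤sumFin (f ∘ Fin.suc) j)
two-terms≤sumFin f {Fin.suc i} {Fin.zero}  _   = begin
  f (Fin.suc i) + f Fin.zero ≡⟨ +-comm (f (Fin.suc i)) (f Fin.zero) ⟩
  f Fin.zero + f (Fin.suc i) ≤⟨ +-monoʳ-≤ (f Fin.zero) (term≤sumFin (f ∘ Fin.suc) i) ⟩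
  sumFin f                   ∎
  where open ≤-Reasoning
two-terms≤sumFin f {Fin.suc i} {Fin.suc j} i≢j =
  ≤-trans (two-terms≤sumFin (f ∘ Fin.suc) (i≢j ∘ cong Fin.suc)) (m≤n+m _ _)

1≤sumFin⇒∃1≤term : ∀ {n} (f : Fin n → ℕ) → 1 ≤ sumFin f → ∃ λ i → 1 ≤ f i
1≤sumFin⇒∃1≤term {suc n} f 1≤Σf with f Fin.zero in eq
... | suc _ = Fin.zero , subst (1 ≤_) (sym eq) (s≤s z≤n)
... | zero  with 1≤sumFin⇒∃1≤term (f ∘ Fin.suc) 1≤Σf
...   | i , 1≤fi = Fin.suc i , 1≤fi

2≤sumFin⇒ : ∀ {n} (f : Fin n → ℕ) → 2 ≤ sumFin f →
  (∃ λ i → 2 ≤ f i) ⊎ (Σ (Fin n) λ i → Σ (Fin n) λ j → i ≢ j × 1 ≤ f i × 1 ≤ f j)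
2≤sumFin⇒ {suc n} f 2≤Σf with f Fin.zero in eq
... | suc (suc _) = inj₁ (Fin.zero , subst (2 ≤_) (sym eq) (s≤s (s≤s z≤n)))
... | suc zero with 1≤sumFin⇒∃1≤term (f ∘ Fin.suc) (s≤s⁻¹ 2≤Σf)
...   | j , 1≤fj = inj₂ (Fin.zero , Fin.suc j , (λ ()) , subst (1 ≤_) (sym eq) (s≤s z≤n) , 1≤fj)
2≤sumFin⇒ {suc n} f 2≤Σf | zero with 2≤sumFin⇒ (f ∘ Fin.suc) 2≤Σf
... | inj₁ (i , 2≤fi) = inj₁ (Fin.suc i , 2≤fi)
... | inj₂ (i , j , i≢j , 1≤fi , 1≤fj) = inj₂ (Fin.suc i , Fin.suc j , i≢j ∘ Finₚ.suc-injective , 1≤fi , 1≤fj)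

meetWeight : ∀ {n} → Word n → Word n → ℕ
meetWeight u v = sumFin (λ i → toℕ (u i) ⊓ toℕ (v i))

dist+2*meetWeight≡weight+weight : ∀ {n} (u v : Word n) →
  dist u v + 2 * meetWeight u v ≡ weight u + weight v
dist+2*meetWeight≡weight+weight u v = begin
  dist u v + 2 * meetWeight u v
    ≡⟨ cong₂ (λ a b → a + 2 * b) (sumFin≡sum d) (sumFin≡sum m) ⟩
  sum d + 2 * sum m
    ≡⟨ cong (sum d +_) (*-distribˡ-sum 2 m) ⟩
  sum d + sum (λ i → 2 * m i)
    ≡⟨ ∑-distrib-+ d (λ i → 2 * m i) ⟨
  sum (λ i → d i + 2 * m i)
    ≡⟨ sum-cong-≗ (λ i → ∣m-n∣+2*[m⊓n]≡m+n (toℕ (u i)) (toℕ (v i))) ⟩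
  sum (λ i → toℕ (u i) + toℕ (v i))
    ≡⟨ ∑-distrib-+ (toℕ ∘ u) (toℕ ∘ v) ⟩
  sum (toℕ ∘ u) + sum (toℕ ∘ v)
    ≡⟨ cong₂ _+_ (sumFin≡sum (toℕ ∘ u)) (sumFin≡sum (toℕ ∘ v)) ⟨
  weight u + weight v ∎
  where
  open ≡-Reasoning
  d m : Fin _ → ℕ
  d i = ∣ toℕ (u i) - toℕ (v i) ∣
  m i = toℕ (u i) ⊓ toℕ (v i)

SharesEdge : ∀ {n} → Word n → Word n → Set
SharesEdge {n} u v = Σ (Fin n) λ i → Σ (Fin n) λ j → i ≢ j × EdgeIn i j u × EdgeIn i j v

SharesTwo : ∀ {n} → Word n → Word n → Set
SharesTwo {n} u v = Σ (Fin n) λ i → toℕ (u i) ≡ 2 × toℕ (v i) ≡ 2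

2≤meetWeight⇔ : ∀ {n} (u v : Word n) → 2 ≤ meetWeight u v ⇔ (SharesEdge u v ⊎ SharesTwo u v)
2≤meetWeight⇔ u v = mk⇔
  (λ 2≤mw → [ fromLargeTerm , fromTwoNonzeroTerms ] (2≤sumFin⇒ m 2≤mw))
  [ fromEdge , fromTwo ]
  where
  m : Fin _ → ℕ
  m i = toℕ (u i) ⊓ toℕ (v i)
  nonzero : ∀ {i} → InSupp u i → InSupp v i → 1 ≤ m i
  nonzero ui vi = Equivalence.from 1≤m⊓n⇔ (ui , vi)
  fromEdge : SharesEdge u v → 2 ≤ meetWeight u v
  fromEdge (i , j , i≢j , (ui , uj) , (vi , vj)) =
    ≤-trans (+-mono-≤ (nonzero ui vi) (nonzero uj vj)) (two-terms≤sumFin m i≢j)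
  fromTwo : SharesTwo u v → 2 ≤ meetWeight u v
  fromTwo (i , ui≡2 , vi≡2) =
    ≤-trans (⊓-glb (≤-reflexive (sym ui≡2)) (≤-reflexive (sym vi≡2))) (term≤sumFin m i)
  fromLargeTerm : (∃ λ i → 2 ≤ m i) → SharesEdge u v ⊎ SharesTwo u v
  fromLargeTerm (i , 2≤mi) = inj₂ (i , 2≤toℕ⇒toℕ≡2 (u i) (m≤n⊓o⇒m≤n _ _ 2≤mi)
                                     , 2≤toℕ⇒toℕ≡2 (v i) (m≤n⊓o⇒m≤o _ _ 2≤mi))
  fromTwoNonzeroTerms : (Σ (Fin _) λ i → Σ (Fin _) λ j → i ≢ j × 1 ≤ m i × 1 ≤ m j) →
    SharesEdge u v ⊎ SharesTwo u v
  fromTwoNonzeroTerms (i , j , i≢j , 1≤mi , 1≤mj) =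
    let (ui , vi) = Equivalence.to 1≤m⊓n⇔ 1≤mi
        (uj , vj) = Equivalence.to 1≤m⊓n⇔ 1≤mj
    in inj₁ (i , j , i≢j , (ui , uj) , (vi , vj))

2*w∸2≤d⇔m≤1 : ∀ {w d m} → d + 2 * m ≡ 2 * w → (2 * w ∸ 2 ≤ d ⇔ m ≤ 1)
2*w∸2≤d⇔m≤1 {w} {d} {m} d+2m≡2w = mk⇔
  (λ 2w∸2≤d → *-cancelˡ-≤ 2 (+-cancelˡ-≤ d _ _ (begin
     d + 2 * m       ≡⟨ d+2m≡2w ⟩
     2 * w           ≤⟨ m≤n+m∸n (2 * w) 2 ⟩
     2 + (2 * w ∸ 2) ≤⟨ +-monoʳ-≤ 2 2w∸2≤d ⟩
     2 + d           ≡⟨ +-comm 2 d ⟩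
     d + 2           ∎)))
  (λ m≤1 → m≤n+o⇒m∸n≤o (2 * w) 2 (begin
     2 * w           ≡⟨ d+2m≡2w ⟨
     d + 2 * m       ≤⟨ +-monoʳ-≤ d (*-monoʳ-≤ 2 m≤1) ⟩
     d + 2           ≡⟨ +-comm d 2 ⟩
     2 + d           ∎))
  where open ≤-Reasoning

2*w∸2≤dist⇔¬shared : ∀ {n w} {u v : Word n} → weight u ≡ w → weight v ≡ w →
  (2 * w ∸ 2 ≤ dist u v ⇔ (¬ (SharesEdge u v ⊎ SharesTwo u v)))
2*w∸2≤dist⇔¬shared {w = w} {u} {v} wu≡w wv≡w = mk⇔
  (λ apart shared → ≤⇒≯ (Equivalence.to bound apart) (Equivalence.from (2≤meetWeight⇔ u v) shared))
  (λ unshared → Equivalence.from bound (≮⇒≥ (unshared ∘ Equivalence.to (2≤meetWeight⇔ u v))))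
  where
  bound : 2 * w ∸ 2 ≤ dist u v ⇔ meetWeight u v ≤ 1
  bound = 2*w∸2≤d⇔m≤1 {w} (begin
    dist u v + 2 * meetWeight u v ≡⟨ dist+2*meetWeight≡weight+weight u v ⟩
    weight u + weight v           ≡⟨ cong₂ _+_ wu≡w wv≡w ⟩
    w + w                         ≡⟨ cong (w +_) (+-identityʳ w) ⟨
    2 * w                         ∎)
    where open ≡-Reasoning

_≐?_ : ∀ {n} (u v : Word n) → Dec (u ≐ v)
u ≐? v = Finₚ.all? (λ i → u i Finₚ.≟ v i)

corollary1 : (n w : ℕ) → n ≥ 1 → w ≥ 1 → (C : Code n) → ConstantWeight C w →
    (IsCode n (2 * w ∸ 2) w C ⇔ (IsPacking C × AtMostOneTwo C))
corollary1 n w _ _ C cw = mk⇔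
  (λ (_ , apart) →
      (λ i j i≢j u v cu cv eu ev → equal-if-shared apart cu cv (inj₁ (i , j , i≢j , eu , ev)))
    , (λ i u v cu cv ui≡2 vi≡2 → equal-if-shared apart cu cv (inj₂ (i , ui≡2 , vi≡2))))
  (λ (packing , twos) → cw , λ u v cu cv u≢v →
    Equivalence.from (2*w∸2≤dist⇔¬shared (cw u cu) (cw v cv))
      [ (λ (i , j , i≢j , eu , ev) → u≢v (packing i j i≢j u v cu cv eu ev))
      , (λ (i , ui≡2 , vi≡2) → u≢v (twos i u v cu cv ui≡2 vi≡2)) ])
  where
  equal-if-shared : (∀ u v → C u → C v → ¬ (u ≐ v) → dist u v ≥ 2 * w ∸ 2) →
    ∀ {u v} → C u → C v → SharesEdge u v ⊎ SharesTwo u v → u ≐ v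
  equal-if-shared apart {u} {v} cu cv shared = decidable-stable (u ≐? v) λ u≢v →
    Equivalence.to (2*w∸2≤dist⇔¬shared (cw u cu) (cw v cv)) (apart u v cu cv u≢v) shared
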